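{- Let $n$ be a positive even integer. Then the signed cardinality statistic is not homomesic under rowmotion on $\mathcal{IC}([2]\times[n])$; that is, the average of $\mathrm{sc}$ over rowmotion orbits is not the same for all orbits.
   Context: $[2]\times[n]=\{(i,j): i\in\{1,2\},1\le j\le n\}$ with the componentwise order. An interval-closed set (ICS) is a subset $I$ with $x,y\in I$, $x\le z\le y\Rightarrow z\in I$; $\mathcal{IC}(P)$ is the set of ICS. The toggle $t_x$ sends $I$ to $I\triangle\{x\}$ if this is an ICS, and to $I$ otherwise; rowmotion is $\mathrm{Row}=t_{x_1}\circ\cdots\circ t_{x_N}$ for any linear extension $x_1,\dots,x_N$ (toggles applied top to bottom). The rank of $(i,j)$ is $i+j-2$; $\mathrm{sc}(x)=(-1)^{\mathrm{rank}(x)}$ and $\mathrm{sc}(I)=\sum_{x\in I}\mathrm{sc}(x)$. A statistic is homomesic if its average over every orbit equals the same constant. -}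

module Defs where

open import Data.Bool using (Bool; true; false; not)
open import Data.Bool.Properties using () renaming (_≟_ to _≟ᵇ_)
open import Data.Nat using (ℕ; zero; suc; _≤_; _<_; _+_)
open import Data.Nat.Properties using (_≤?_)
open import Data.Fin using (Fin; toℕ)
open import Data.Fin.Properties using (all?)
open import Data.Product using (∃; _×_; _,_; proj₁; proj₂)
open import Data.Vec using (Vec; lookup; _[_]%=_)
open import Data.List using (List; []; _∷_; _++_; map; foldr; concatMap)
open import Data.Integer using (ℤ; +_; -_)
import Data.Integer as ℤ
open import Data.Rational using (ℚ; _/_; 0ℚ)
open import Relation.Binary.PropositionalEquality using (_≡_; _≢_)
open import Relation.Nullary using (Dec; yes; no; map′; ¬_)
open import Relation.Nullary.Decidable using (_×-dec_; _→-dec_)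
open import Data.Fin.Base using (zero; suc)
import Data.List as List

-- The poset [2] × [n]: element (i , j) with i : Fin 2, j : Fin n
-- (0-indexed, so (i , j) represents the paper's (i+1 , j+1)).
Pt : ℕ → Set
Pt n = Fin 2 × Fin n

_≤P_ : ∀ {n} → Pt n → Pt n → Set
(i , j) ≤P (i' , j') = (toℕ i ≤ toℕ i') × (toℕ j ≤ toℕ j')

-- rank of (i+1, j+1) is (i+1)+(j+1)-2 = i + j
rank : ∀ {n} → Pt n → ℕ
rank (i , j) = toℕ i + toℕ j

SubsetP : ℕ → Set
SubsetP n = Vec (Vec Bool n) 2

_∈P_ : ∀ {n} → Pt n → SubsetP n → Set
(i , j) ∈P I = lookup (lookup I i) j ≡ true

IsICS : ∀ {n} → SubsetP n → Set
IsICS {n} I = (x y z : Pt n) → x ∈P I → y ∈P I → x ≤P z → z ≤P y → z ∈P I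

allPt? : ∀ {n} {P : Pt n → Set} → ((x : Pt n) → Dec (P x)) → Dec ((x : Pt n) → P x)
allPt? {P = P} P? =
  map′ (λ f x → f (proj₁ x) (proj₂ x)) (λ f i j → f (i , j))
       (all? (λ i → all? (λ j → P? (i , j))))

_∈P?_ : ∀ {n} (x : Pt n) (I : SubsetP n) → Dec (x ∈P I)
(i , j) ∈P? I = lookup (lookup I i) j ≟ᵇ true

_≤P?_ : ∀ {n} (x y : Pt n) → Dec (x ≤P y)
(i , j) ≤P? (i' , j') = (toℕ i ≤? toℕ i') ×-dec (toℕ j ≤? toℕ j')

IsICS? : ∀ {n} (I : SubsetP n) → Dec (IsICS I)
IsICS? I = allPt? λ x → allPt? λ y → allPt? λ z →
  (x ∈P? I) →-dec (y ∈P? I) →-dec (x ≤P? z) →-dec (z ≤P? y) →-dec (z ∈P? I)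

flip : ∀ {n} → Pt n → SubsetP n → SubsetP n
flip (i , j) I = I [ i ]%= (λ row → row [ j ]%= not)

toggle : ∀ {n} → Pt n → SubsetP n → SubsetP n
toggle x I with IsICS? (flip x I)
... | yes _ = flip x I
... | no  _ = I

-- all elements, in the linear extension
-- (1,1),(1,2),…,(1,n),(2,1),…,(2,n)
linExt : (n : ℕ) → List (Pt n)
linExt n = concatMap (λ i → map (λ j → (i , j)) (List.allFin n)) (List.allFin 2)

-- Row = t_{x1} ∘ t_{x2} ∘ ⋯ ∘ t_{xN}  (t_{xN} applied first)
Row : ∀ {n} → SubsetP n → SubsetP n
Row {n} I = foldr toggle I (linExt n)

iterate : ∀ {A : Set} → (A → A) → ℕ → A → A
iterate f zero    a = a
iterate f (suc k) a = f (iterate f k a)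

scPt : ∀ {n} → Pt n → ℤ
scPt x = ℤ.-1ℤ ℤ.^ rank x

sc : ∀ {n} → SubsetP n → ℤ
sc {n} I = List.foldr ℤ._+_ (+ 0)
  (map (λ x → scMember x (x ∈P? I)) (linExt n))
  where
  scMember : Pt n → ∀ {P : Set} → Dec P → ℤ
  scMember x (yes _) = scPt x
  scMember x (no _)  = + 0

IsOrbitSize : ∀ {n} → SubsetP n → ℕ → Set
IsOrbitSize I k =
  (0 < k) × (iterate Row k I ≡ I) × (∀ j → 0 < j → j < k → iterate Row j I ≢ I)

orbitSum : ∀ {n} → SubsetP n → ℕ → ℤ
orbitSum I zero    = + 0
orbitSum I (suc k) = orbitSum I k ℤ.+ sc (iterate Row k I)

orbitAvg : ∀ {n} → SubsetP n → ℕ → ℚ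
orbitAvg I zero    = 0ℚ
orbitAvg I (suc k) = orbitSum I (suc k) / suc k

ScHomomesic : ℕ → Set
ScHomomesic n = ∃ λ (c : ℚ) →
  (I : SubsetP n) → IsICS I → (k : ℕ) → IsOrbitSize I k → orbitAvg I k ≡ c

{-# OPTIONS --safe #-}
module Submission where

-- Write n = 2 + 2t; two rowmotion orbits have different sc-averages. The empty set and the whole
-- poset swap, with average 0. The singleton of the minimum runs through the rank levels (the
-- elements of rank 0, 1, …, n), then the poset without its maximum and the poset without its
-- minimum, returning after n + 3 steps with sc-sum −2. Each of these sets is a pair of row
-- intervals, so a rowmotion step is a sweep of toggles along the top row and then the bottom row in
-- which every toggle either moves an interval endpoint or is blocked by the gap it would open
-- between two elements. The sc of a pair of intervals is a difference of alternating partial sums,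
-- which vanish at even lengths.

open import Defs
open import Data.Nat using (ℕ; _<_)
open import Data.Nat.Divisibility using (_∣_)
open import Relation.Nullary using (¬_)

open import Data.Bool using (Bool; true; false; not; if_then_else_)
open import Data.Bool.Properties using (¬-not)
open import Data.Empty using (⊥-elim)
open import Data.Fin using (Fin; toℕ; fromℕ<; zero; suc)
open import Data.Fin.Properties using (_≟_; toℕ-fromℕ<; toℕ<n; toℕ-injective; fromℕ<-toℕ; fromℕ<-injective)
open import Data.List using (List; []; _∷_; _++_; foldr; map; allFin)
import Data.List as List
open import Data.List.Properties using (foldr-++; map-tabulate; map-cong; map-++; ++-identityʳ)
import Data.List.Properties as Listₚ
open import Data.Nat using (zero; suc; _≤_; _∸_; _⊓_; _*_; z≤n; s≤s)
open import Data.Nat.Properties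
  using (_≤?_; _<?_; ≤-refl; ≤-trans; ≤-<-trans; <-≤-trans; <-trans; <⇒≤; <⇒≱; <⇒≢; ≤∧≢⇒<; ≤-pred;
         m<n⇒m<1+n; n≤1+n; n<1+n; m∸n≤m; <-cmp; m≤n⇒m<n∨m≡n; <-irrefl; ≤-antisym;
         ≮⇒≥; m≤n⇒m≤1+n; m≤n⇒m⊓n≡m; m≥n⇒m⊓n≡n)
open import Data.Product using (_×_; _,_; proj₁; proj₂)
open import Data.Sum using (_⊎_; inj₁; inj₂)
open import Data.Integer using (ℤ; +_; -[1+_]; -_; _+_; _-_; _^_; -1ℤ)
import Data.Integer.Properties as ℤ
open import Data.Integer.Tactic.RingSolver using (solve-∀)
open import Data.Nat.Divisibility using (divides)
open import Data.Rational using (_/_)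
open import Data.Rational.Properties using (/-injective-≃)
open import Data.Rational.Unnormalised.Base using (mkℚᵘ; *≡*)
open import Data.Vec using (Vec; []; _∷_; lookup; tabulate; _[_]%=_)
open import Data.Vec.Properties using (lookup∘tabulate; lookup∘updateAt; lookup∘updateAt′; tabulate∘lookup; tabulate-cong)
open import Function using (_∘_; id; case_of_)
open import Function.Bundles using (_⇔_; mk⇔)
open import Function.Construct.Symmetry using (⇔-sym)
open import Function.Construct.Identity using (⇔-id)
open import Relation.Binary using (tri<; tri≈; tri>)
open import Relation.Binary.PropositionalEquality using (_≡_; _≢_; refl; sym; trans; cong; cong₂; subst; subst₂; module ≡-Reasoning)
open import Relation.Nullary using (Dec; yes; no; does; proof; ¬?)
open import Relation.Nullary.Reflects using (Reflects; invert)
open import Relation.Nullary.Decidable using (_×-dec_; dec-true; dec-false; does-⇔)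

-- Intervals of columns

record Interval : Set where
  constructor [_,_⟩
  field
    lo hi : ℕ

_∈ᵢ_ : ℕ → Interval → Set
k ∈ᵢ [ a , b ⟩ = a ≤ k × k < b

_∈ᵢ?_ : ∀ k I → Dec (k ∈ᵢ I)
k ∈ᵢ? [ a , b ⟩ = (a ≤? k) ×-dec (k <? b)

∈ᵢ-convex : ∀ {I x y z} → x ∈ᵢ I → y ∈ᵢ I → x ≤ z → z ≤ y → z ∈ᵢ I
∈ᵢ-convex {[ a , b ⟩} (a≤x , _) (_ , y<b) x≤z z≤y = ≤-trans a≤x x≤z , ≤-<-trans z≤y y<b

∉-empty : ∀ {k a b} → b ≤ a → ¬ k ∈ᵢ [ a , b ⟩
∉-empty b≤a (a≤k , k<b) = <⇒≱ (<-≤-trans k<b b≤a) a≤k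

∉-below : ∀ {k a b} → k < a → ¬ k ∈ᵢ [ a , b ⟩
∉-below k<a (a≤k , _) = <⇒≱ k<a a≤k

∉-above : ∀ {k a b} → b ≤ k → ¬ k ∈ᵢ [ a , b ⟩
∉-above b≤k (_ , k<b) = <⇒≱ k<b b≤k

both-absent : ∀ {A B : Set} → ¬ A → ¬ B → A ⇔ B
both-absent ¬a ¬b = mk⇔ (⊥-elim ∘ ¬a) (⊥-elim ∘ ¬b)

record FlipsTo (I : Interval) (k : ℕ) (J : Interval) : Set where
  constructor flipsTo
  field
    at-k      : k ∈ᵢ J ⇔ (¬ k ∈ᵢ I)
    elsewhere : ∀ {k′} → k′ ≢ k → k′ ∈ᵢ J ⇔ k′ ∈ᵢ I

flip-extendʳ : ∀ {a k} → a ≤ k → FlipsTo [ a , k ⟩ k [ a , suc k ⟩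
flip-extendʳ {k = k} a≤k =
  flipsTo (mk⇔ (λ _ (_ , k<k) → <-irrefl refl k<k) (λ _ → a≤k , n<1+n k))
  λ k′≢k → mk⇔ (λ (a≤k′ , k′≤k) → a≤k′ , ≤∧≢⇒< (≤-pred k′≤k) k′≢k)
                (λ (a≤k′ , k′<k) → a≤k′ , m<n⇒m<1+n k′<k)

flip-extendˡ : ∀ {k b} → k < b → FlipsTo [ suc k , b ⟩ k [ k , b ⟩
flip-extendˡ {k} k<b =
  flipsTo (mk⇔ (λ _ (k<k , _) → <-irrefl refl k<k) (λ _ → ≤-refl , k<b))
  λ k′≢k → mk⇔ (λ (k≤k′ , k′<b) → ≤∧≢⇒< k≤k′ (k′≢k ∘ sym) , k′<b)
                (λ (k<k′ , k′<b) → <⇒≤ k<k′ , k′<b)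

flip-shrinkʳ : ∀ {a k} → a ≤ k → FlipsTo [ a , suc k ⟩ k [ a , k ⟩
flip-shrinkʳ {k = k} a≤k =
  flipsTo (mk⇔ (λ (_ , k<k) → ⊥-elim (<-irrefl refl k<k)) (λ k∉ → ⊥-elim (k∉ (a≤k , n<1+n k))))
  λ k′≢k → ⇔-sym (FlipsTo.elsewhere (flip-extendʳ a≤k) k′≢k)

flip-shrinkˡ : ∀ {k b} → k < b → FlipsTo [ k , b ⟩ k [ suc k , b ⟩
flip-shrinkˡ {k} k<b =
  flipsTo (mk⇔ (λ (k<k , _) → ⊥-elim (<-irrefl refl k<k)) (λ k∉ → ⊥-elim (k∉ (≤-refl , k<b))))
  λ k′≢k → ⇔-sym (FlipsTo.elsewhere (flip-extendˡ k<b) k′≢k)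

flip-fill : ∀ {a b k} → b ≤ a → FlipsTo [ a , b ⟩ k [ k , suc k ⟩
flip-fill {k = k} b≤a =
  flipsTo (mk⇔ (λ _ → ∉-empty b≤a) (λ _ → ≤-refl , n<1+n k))
  λ k′≢k → mk⇔ (λ (k≤k′ , k′<1+k) → ⊥-elim (k′≢k (≤-antisym (≤-pred k′<1+k) k≤k′)))
                (⊥-elim ∘ ∉-empty b≤a)

-- Opaque, so that unifying two interval pairs compares their intervals instead of tabulated rows.
opaque
  indicator : ∀ {n} → Interval → Vec Bool n
  indicator I = tabulate λ j → does (toℕ j ∈ᵢ? I)

opaque
  unfolding indicator

  lookup-indicator : ∀ {n} I (j : Fin n) → lookup (indicator I) j ≡ does (toℕ j ∈ᵢ? I)
  lookup-indicator I = lookup∘tabulate _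

  indicator-cong : ∀ {n I J} → (∀ {k} → k < n → k ∈ᵢ I ⇔ k ∈ᵢ J) → indicator {n} I ≡ indicator J
  indicator-cong {I = I} {J} I⇔J = tabulate-cong λ j → does-⇔ (I⇔J (toℕ<n j)) (toℕ j ∈ᵢ? I) (toℕ j ∈ᵢ? J)

indicator-∈ : ∀ {n k} I {j : Fin n} → toℕ j ≡ k → k ∈ᵢ I → lookup (indicator I) j ≡ true
indicator-∈ {k = k} I {j} refl k∈I = trans (lookup-indicator I j) (dec-true (k ∈ᵢ? I) k∈I)

indicator-∉ : ∀ {n k} I {j : Fin n} → toℕ j ≡ k → ¬ k ∈ᵢ I → lookup (indicator I) j ≡ false
indicator-∉ {k = k} I {j} refl k∉I = trans (lookup-indicator I j) (dec-false (k ∈ᵢ? I) k∉I)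

∈-indicator : ∀ {n} I {j : Fin n} → lookup (indicator I) j ≡ true → toℕ j ∈ᵢ I
∈-indicator I {j} e =
  invert (subst (Reflects _) (trans (sym (lookup-indicator I j)) e) (proof (toℕ j ∈ᵢ? I)))

flipped-∈ : ∀ {n k} I {j : Fin n} → toℕ j ≡ k → ¬ k ∈ᵢ I → lookup (indicator I [ j ]%= not) j ≡ true
flipped-∈ I {j} j≡k k∉I = trans (lookup∘updateAt j (indicator I)) (cong not (indicator-∉ I j≡k k∉I))

flipped-∉ : ∀ {n k} I {j : Fin n} → toℕ j ≡ k → k ∈ᵢ I → lookup (indicator I [ j ]%= not) j ≡ false
flipped-∉ I {j} j≡k k∈I = trans (lookup∘updateAt j (indicator I)) (cong not (indicator-∈ I j≡k k∈I))

flipped-other : ∀ {n} I {j j′ : Fin n} → j′ ≢ j → lookup (indicator I [ j ]%= not) j′ ≡ lookup (indicator I) j′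
flipped-other I j′≢j = lookup∘updateAt′ _ _ j′≢j (indicator I)

rows : ∀ {n} → Interval → Interval → SubsetP n
rows I₀ I₁ = indicator I₀ ∷ indicator I₁ ∷ []

rows-cong : ∀ {n I₀ I₁ J₀ J₁} →
            (∀ {k} → k < n → k ∈ᵢ I₀ ⇔ k ∈ᵢ J₀) → (∀ {k} → k < n → k ∈ᵢ I₁ ⇔ k ∈ᵢ J₁) →
            rows {n} I₀ I₁ ≡ rows J₀ J₁
rows-cong same₀ same₁ = cong₂ (λ r₀ r₁ → r₀ ∷ r₁ ∷ []) (indicator-cong same₀) (indicator-cong same₁)

vec-ext : ∀ {A : Set} {n} {xs ys : Vec A n} → (∀ j → lookup xs j ≡ lookup ys j) → xs ≡ ys
vec-ext {xs = xs} {ys} pointwise = trans (sym (tabulate∘lookup xs)) (trans (tabulate-cong pointwise) (tabulate∘lookup ys))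

indicator-flip : ∀ {n k I J} (j : Fin n) → toℕ j ≡ k → FlipsTo I k J → indicator I [ j ]%= not ≡ indicator J
indicator-flip {I = I} {J} j refl (flipsTo at-j elsewhere) = vec-ext pointwise
  where
  open ≡-Reasoning
  pointwise : ∀ j′ → lookup (indicator I [ j ]%= not) j′ ≡ lookup (indicator J) j′
  pointwise j′ with j′ ≟ j
  ... | yes refl = begin
    lookup (indicator I [ j ]%= not) j   ≡⟨ lookup∘updateAt j (indicator I) ⟩
    not (lookup (indicator I) j)         ≡⟨ cong not (lookup-indicator I j) ⟩
    does (¬? (toℕ j ∈ᵢ? I))              ≡⟨ does-⇔ at-j (toℕ j ∈ᵢ? J) (¬? (toℕ j ∈ᵢ? I)) ⟨
    does (toℕ j ∈ᵢ? J)                   ≡⟨ lookup-indicator J j ⟨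
    lookup (indicator J) j               ∎
  ... | no j′≢j = begin
    lookup (indicator I [ j ]%= not) j′  ≡⟨ lookup∘updateAt′ j′ j j′≢j (indicator I) ⟩
    lookup (indicator I) j′              ≡⟨ lookup-indicator I j′ ⟩
    does (toℕ j′ ∈ᵢ? I)                  ≡⟨ does-⇔ (elsewhere (j′≢j ∘ toℕ-injective)) (toℕ j′ ∈ᵢ? J) (toℕ j′ ∈ᵢ? I) ⟨
    does (toℕ j′ ∈ᵢ? J)                  ≡⟨ lookup-indicator J j′ ⟨
    lookup (indicator J) j′              ∎

data Stackable (I₀ I₁ : Interval) : Set where
  empty-bottom : Interval.hi I₀ ≤ Interval.lo I₀ → Stackable I₀ I₁
  top-≤-bottom : Interval.hi I₁ ≤ Interval.hi I₀ → Interval.lo I₁ ≤ Interval.lo I₀ → Stackable I₀ I₁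

rows-isICS : ∀ {n I₀ I₁} → Stackable I₀ I₁ → IsICS (rows {n} I₀ I₁)
rows-isICS {I₀ = I₀} _ (zero , _) (zero , _) (zero , _) x∈ y∈ (_ , xj≤zj) (_ , zj≤yj) =
  indicator-∈ I₀ refl (∈ᵢ-convex (∈-indicator I₀ x∈) (∈-indicator I₀ y∈) xj≤zj zj≤yj)
rows-isICS {I₁ = I₁} _ (suc zero , _) (suc zero , _) (suc zero , _) x∈ y∈ (_ , xj≤zj) (_ , zj≤yj) =
  indicator-∈ I₁ refl (∈ᵢ-convex (∈-indicator I₁ x∈) (∈-indicator I₁ y∈) xj≤zj zj≤yj)
rows-isICS _ (suc zero , _) _ (zero , _) _ _ (() , _) _
rows-isICS _ _ (zero , _) (suc zero , _) _ _ _ (() , _)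
rows-isICS {I₀ = I₀@([ _ , _ ⟩)} (empty-bottom hi≤lo) (zero , xj) (suc zero , _) _ x∈ _ _ _
  with (lo≤xj , xj<hi) ← ∈-indicator I₀ {xj} x∈ = ⊥-elim (<⇒≱ (<-≤-trans xj<hi hi≤lo) lo≤xj)
rows-isICS {I₀ = I₀@([ _ , _ ⟩)} {I₁@([ _ , _ ⟩)} (top-≤-bottom hi₁≤hi₀ _)
           (zero , _) (suc zero , _) (zero , _) x∈ y∈ (_ , xj≤zj) (_ , zj≤yj)
  with (lo₀≤xj , _) ← ∈-indicator I₀ x∈ | (_ , yj<hi₁) ← ∈-indicator I₁ y∈ =
  indicator-∈ I₀ refl (≤-trans lo₀≤xj xj≤zj , ≤-<-trans zj≤yj (<-≤-trans yj<hi₁ hi₁≤hi₀))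
rows-isICS {I₀ = I₀@([ _ , _ ⟩)} {I₁@([ _ , _ ⟩)} (top-≤-bottom _ lo₁≤lo₀)
           (zero , _) (suc zero , _) (suc zero , _) x∈ y∈ (_ , xj≤zj) (_ , zj≤yj)
  with (lo₀≤xj , _) ← ∈-indicator I₀ x∈ | (_ , yj<hi₁) ← ∈-indicator I₁ y∈ =
  indicator-∈ I₁ refl (≤-trans lo₁≤lo₀ (≤-trans lo₀≤xj xj≤zj) , ≤-<-trans zj≤yj yj<hi₁)

-- A record rather than toggle x S ≡ S′, so that Agda matches these facts by S, x and S′ instead of
-- evaluating the ICS test inside toggle.
record _─⟨_⟩→_ {n} (S : SubsetP n) (x : Pt n) (S′ : SubsetP n) : Set where
  constructor toggles
  field
    toggle-≡ : toggle x S ≡ S′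
open _─⟨_⟩→_

toggle-accept : ∀ {n} (x : Pt n) S → IsICS (flip x S) → S ─⟨ x ⟩→ flip x S
toggle-accept x S ics = toggles accepted
  where
  accepted : toggle x S ≡ flip x S
  accepted with IsICS? (flip x S)
  ... | yes _    = refl
  ... | no ¬ics = ⊥-elim (¬ics ics)

toggle-reject : ∀ {n} (x : Pt n) S → ¬ IsICS (flip x S) → S ─⟨ x ⟩→ S
toggle-reject x S ¬ics = toggles rejected
  where
  rejected : toggle x S ≡ S
  rejected with IsICS? (flip x S)
  ... | yes ics = ⊥-elim (¬ics ics)
  ... | no _    = refl

toggle-accept-into : ∀ {n} {x : Pt n} {S T} → flip x S ≡ T → IsICS T → S ─⟨ x ⟩→ T
toggle-accept-into {x = x} {S} refl ics = toggle-accept x S ics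

toggle-bottom : ∀ {n k I₀ I₁ J₀} (k<n : k < n) → FlipsTo I₀ k J₀ → Stackable J₀ I₁ →
                rows I₀ I₁ ─⟨ zero , fromℕ< k<n ⟩→ rows J₀ I₁
toggle-bottom k<n I₀↝J₀ stack =
  toggle-accept-into (cong (_∷ _) (indicator-flip _ (toℕ-fromℕ< k<n) I₀↝J₀)) (rows-isICS stack)

toggle-top : ∀ {n k I₀ I₁ J₁} (k<n : k < n) → FlipsTo I₁ k J₁ → Stackable I₀ J₁ →
             rows I₀ I₁ ─⟨ suc zero , fromℕ< k<n ⟩→ rows I₀ J₁
toggle-top k<n I₁↝J₁ stack =
  toggle-accept-into (cong (λ r → _ ∷ r ∷ []) (indicator-flip _ (toℕ-fromℕ< k<n) I₁↝J₁)) (rows-isICS stack)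

toggle-blocked : ∀ {n} {x : Pt n} {S} u (w : Pt n) v → let T = flip x S in
                 u ∈P T → v ∈P T → u ≤P w → w ≤P v → lookup (lookup T (proj₁ w)) (proj₂ w) ≡ false → S ─⟨ x ⟩→ S
toggle-blocked u (wi , wj) v u∈ v∈ u≤w w≤v w∉ =
  toggle-reject _ _ λ ics → case trans (sym (ics u v (wi , wj) u∈ v∈ u≤w w≤v)) w∉ of λ ()

fromℕ<-≤P : ∀ {n i i′ k k′} (h : k < n) (h′ : k′ < n) →
            toℕ i ≤ toℕ i′ → k ≤ k′ → (i , fromℕ< h) ≤P (i′ , fromℕ< h′)
fromℕ<-≤P h h′ i≤i′ k≤k′ = i≤i′ , subst₂ _≤_ (sym (toℕ-fromℕ< h)) (sym (toℕ-fromℕ< h′)) k≤k′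

fromℕ<-≢ : ∀ {n k k′} (h : k < n) (h′ : k′ < n) → k ≢ k′ → fromℕ< h ≢ fromℕ< h′
fromℕ<-≢ {k = k} {k′} h h′ k≢k′ = k≢k′ ∘ fromℕ<-injective k k′ h h′

toggles-resp-≡ : ∀ {n} {x : Pt n} {S S′ T T′} → S ≡ T → T ─⟨ x ⟩→ T′ → S′ ≡ T′ → S ─⟨ x ⟩→ S′
toggles-resp-≡ refl step refl = step

-- Rowmotion as two row sweeps

foldr-tabulate-chain : ∀ {A B : Set} {m} (g : A → B → B) (f : Fin m → A) (G : ℕ → B) →
                       (∀ j → g (f j) (G (suc (toℕ j))) ≡ G (toℕ j)) → foldr g (G m) (List.tabulate f) ≡ G 0
foldr-tabulate-chain {m = zero}  g f G step = refl
foldr-tabulate-chain {m = suc m} g f G step =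
  trans (cong (g (f zero)) (foldr-tabulate-chain g (f ∘ suc) (G ∘ suc) (step ∘ suc))) (step zero)

rowPoints : ∀ {n} → Fin 2 → List (Pt n)
rowPoints {n} i = map (i ,_) (allFin n)

Row-by-rows : ∀ {n} (S : SubsetP n) → Row S ≡ foldr toggle (foldr toggle S (rowPoints (suc zero))) (rowPoints zero)
Row-by-rows S = trans (foldr-++ toggle S (rowPoints zero) _)
                      (cong (λ T → foldr toggle T (rowPoints zero)) (foldr-++ toggle S (rowPoints (suc zero)) []))

Sweeps : ∀ {n} → Fin 2 → (ℕ → SubsetP n) → Set
Sweeps {n} i G = ∀ k (k<n : k < n) → G (suc k) ─⟨ i , fromℕ< k<n ⟩→ G k

sweep : ∀ {n} i (G : ℕ → SubsetP n) → Sweeps i G → foldr toggle (G n) (rowPoints i) ≡ G 0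
sweep {n} i G steps = trans (cong (foldr toggle (G n)) (map-tabulate id (i ,_))) (foldr-tabulate-chain toggle (i ,_) G step)
  where
  step : ∀ j → toggle (i , j) (G (suc (toℕ j))) ≡ G (toℕ j)
  step j = toggle-≡ (subst (λ j′ → G (suc (toℕ j)) ─⟨ i , j′ ⟩→ G (toℕ j))
                           (fromℕ<-toℕ j (toℕ<n j)) (steps (toℕ j) (toℕ<n j)))

Row-sweeps : ∀ {n} {S S′ : SubsetP n} (top bottom : ℕ → SubsetP n) →
             S ≡ top n → Sweeps (suc zero) top → bottom n ≡ top 0 → Sweeps zero bottom → bottom 0 ≡ S′ → Row S ≡ S′
Row-sweeps {n} top bottom refl top-steps junction bottom-steps refl = begin
  Row (top n)                                                                   ≡⟨ Row-by-rows (top n) ⟩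
  foldr toggle (foldr toggle (top n) (rowPoints (suc zero))) (rowPoints zero)   ≡⟨ cong (λ T → foldr toggle T row₀) top-sweep ⟩
  foldr toggle (bottom n) (rowPoints zero)                                      ≡⟨ sweep zero bottom bottom-steps ⟩
  bottom 0                                                                      ∎
  where
  open ≡-Reasoning
  row₀ : List (Pt n)
  row₀ = rowPoints zero
  top-sweep : foldr toggle (top n) (rowPoints (suc zero)) ≡ bottom n
  top-sweep = trans (sweep (suc zero) top top-steps) (sym junction)

piecewise : ∀ {A : Set} → ℕ → ℕ → A → A → A → A
piecewise zero    zero    below equal above = equal
piecewise zero    (suc _) below equal above = below
piecewise (suc _) zero    below equal above = above
piecewise (suc k) (suc m) = piecewise k m

module _ {A : Set} {below equal above : A} where

  piecewise-< : ∀ {k m} → k < m → piecewise k m below equal above ≡ below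
  piecewise-< {zero}  {suc m} _         = refl
  piecewise-< {suc k} {suc m} (s≤s k<m) = piecewise-< k<m

  piecewise-≡ : ∀ k → piecewise k k below equal above ≡ equal
  piecewise-≡ zero    = refl
  piecewise-≡ (suc k) = piecewise-≡ k

  piecewise-> : ∀ {k m} → m < k → piecewise k m below equal above ≡ above
  piecewise-> {suc k} {zero}  _         = refl
  piecewise-> {suc k} {suc m} (s≤s m<k) = piecewise-> m<k

data Position (k m : ℕ) : Set where
  far-below  : suc k < m → Position k m
  just-below : suc k ≡ m → Position k m
  equal      : k ≡ m     → Position k m
  above      : m < k     → Position k m

position : ∀ k m → Position k m
position k m with <-cmp k m
... | tri> _ _ m<k = above m<k
... | tri≈ _ k≡m _ = equal k≡m
... | tri< k<m _ _ with m≤n⇒m<n∨m≡n k<m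
...   | inj₁ 1+k<m = far-below 1+k<m
...   | inj₂ 1+k≡m = just-below 1+k≡m

-- The two orbits

level : ∀ {n} → ℕ → SubsetP n
level m = rows [ m , suc m ⟩ [ m ∸ 1 , m ⟩

levelTop : ∀ {n} → ℕ → ℕ → SubsetP n
levelTop m k = piecewise k m (rows [ m , suc m ⟩ [ m , suc m ⟩) (rows [ m , suc m ⟩ [ m ∸ 1 , suc m ⟩) (level m)

levelTop-sweeps : ∀ {n} m → m < n → Sweeps (suc zero) (levelTop {n} m)
levelTop-sweeps {n} m m<n k k<n with position k m
... | above m<k = toggles-resp-≡ (piecewise-> (m<n⇒m<1+n m<k)) blocked (piecewise-> m<k)
  where
  blocked : level m ─⟨ suc zero , fromℕ< k<n ⟩→ level m
  blocked = toggle-blocked (zero , fromℕ< m<n) (zero , fromℕ< k<n) (suc zero , fromℕ< k<n)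
    (indicator-∈ [ m , suc m ⟩ (toℕ-fromℕ< m<n) (≤-refl , n<1+n m))
    (flipped-∈ [ m ∸ 1 , m ⟩ (toℕ-fromℕ< k<n) (∉-above (<⇒≤ m<k)))
    (fromℕ<-≤P m<n k<n z≤n (<⇒≤ m<k)) (fromℕ<-≤P k<n k<n z≤n ≤-refl)
    (indicator-∉ [ m , suc m ⟩ (toℕ-fromℕ< k<n) (∉-above m<k))
... | equal refl = toggles-resp-≡ (piecewise-> (n<1+n k))
    (toggle-top k<n (flip-extendʳ (m∸n≤m k 1)) (top-≤-bottom ≤-refl (m∸n≤m k 1))) (piecewise-≡ k)
... | just-below refl = toggles-resp-≡ (piecewise-≡ (suc k))
    (toggle-top k<n (flip-shrinkˡ (m<n⇒m<1+n (n<1+n k))) (top-≤-bottom ≤-refl ≤-refl)) (piecewise-< (n<1+n k))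
... | far-below 1+k<m = toggles-resp-≡ (piecewise-< 1+k<m) blocked (piecewise-< (<-trans (n<1+n k) 1+k<m))
  where
  1+k<n : suc k < n
  1+k<n = <-trans 1+k<m m<n
  blocked : rows [ m , suc m ⟩ [ m , suc m ⟩ ─⟨ suc zero , fromℕ< k<n ⟩→ rows [ m , suc m ⟩ [ m , suc m ⟩
  blocked = toggle-blocked (suc zero , fromℕ< k<n) (suc zero , fromℕ< 1+k<n) (suc zero , fromℕ< m<n)
    (flipped-∈ [ m , suc m ⟩ (toℕ-fromℕ< k<n) (∉-below (<-trans (n<1+n k) 1+k<m)))
    (trans (flipped-other [ m , suc m ⟩ (fromℕ<-≢ m<n k<n (<⇒≢ (<-trans (n<1+n k) 1+k<m) ∘ sym)))
           (indicator-∈ [ m , suc m ⟩ (toℕ-fromℕ< m<n) (≤-refl , n<1+n m)))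
    (fromℕ<-≤P k<n 1+k<n ≤-refl (n≤1+n k)) (fromℕ<-≤P 1+k<n m<n ≤-refl (<⇒≤ 1+k<m))
    (trans (flipped-other [ m , suc m ⟩ (fromℕ<-≢ 1+k<n k<n (<⇒≢ (n<1+n k) ∘ sym)))
           (indicator-∉ [ m , suc m ⟩ (toℕ-fromℕ< 1+k<n) (∉-below 1+k<m)))

levelBottom : ∀ {n} → ℕ → ℕ → SubsetP n
levelBottom m k =
  piecewise k (suc m) (level (suc m)) (rows [ m , suc (suc m) ⟩ [ m , suc m ⟩) (rows [ m , suc m ⟩ [ m , suc m ⟩)

levelBottom-sweeps : ∀ {n} m → m < n → Sweeps zero (levelBottom {n} m)
levelBottom-sweeps {n} m m<n k k<n with position k (suc m)
... | above 1+m<k = toggles-resp-≡ (piecewise-> (m<n⇒m<1+n 1+m<k)) blocked (piecewise-> 1+m<k)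
  where
  1+m<n : suc m < n
  1+m<n = <-trans 1+m<k k<n
  blocked : rows [ m , suc m ⟩ [ m , suc m ⟩ ─⟨ zero , fromℕ< k<n ⟩→ rows [ m , suc m ⟩ [ m , suc m ⟩
  blocked = toggle-blocked (zero , fromℕ< m<n) (zero , fromℕ< 1+m<n) (zero , fromℕ< k<n)
    (trans (flipped-other [ m , suc m ⟩ (fromℕ<-≢ m<n k<n (<⇒≢ (<-trans (n<1+n m) 1+m<k))))
           (indicator-∈ [ m , suc m ⟩ (toℕ-fromℕ< m<n) (≤-refl , n<1+n m)))
    (flipped-∈ [ m , suc m ⟩ (toℕ-fromℕ< k<n) (∉-above (<⇒≤ 1+m<k)))
    (fromℕ<-≤P m<n 1+m<n z≤n (n≤1+n m)) (fromℕ<-≤P 1+m<n k<n z≤n (<⇒≤ 1+m<k))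
    (trans (flipped-other [ m , suc m ⟩ (fromℕ<-≢ 1+m<n k<n (<⇒≢ 1+m<k)))
           (indicator-∉ [ m , suc m ⟩ (toℕ-fromℕ< 1+m<n) (∉-above ≤-refl)))
... | equal refl = toggles-resp-≡ (piecewise-> (n<1+n (suc m)))
    (toggle-bottom k<n (flip-extendʳ (n≤1+n m)) (top-≤-bottom (n≤1+n (suc m)) ≤-refl)) (piecewise-≡ (suc m))
... | just-below refl = toggles-resp-≡ (piecewise-≡ (suc k))
    (toggle-bottom k<n (flip-shrinkˡ (m<n⇒m<1+n (n<1+n k))) (top-≤-bottom (n≤1+n (suc k)) (n≤1+n k))) (piecewise-< (n<1+n k))
... | far-below (s≤s k<m) = toggles-resp-≡ (piecewise-< (s≤s k<m)) blocked (piecewise-< (m<n⇒m<1+n k<m))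
  where
  blocked : level (suc m) ─⟨ zero , fromℕ< k<n ⟩→ level (suc m)
  blocked = toggle-blocked (zero , fromℕ< k<n) (suc zero , fromℕ< k<n) (suc zero , fromℕ< m<n)
    (flipped-∈ [ suc m , suc (suc m) ⟩ (toℕ-fromℕ< k<n) (∉-below (m<n⇒m<1+n k<m)))
    (indicator-∈ [ m , suc m ⟩ (toℕ-fromℕ< m<n) (≤-refl , n<1+n m))
    (fromℕ<-≤P k<n k<n z≤n ≤-refl) (fromℕ<-≤P k<n m<n ≤-refl (<⇒≤ k<m))
    (indicator-∉ [ m , suc m ⟩ (toℕ-fromℕ< k<n) (∉-below k<m))

Row-level : ∀ {n m} → m < n → Row (level {n} m) ≡ level (suc m)
Row-level {n} {m} m<n =
  Row-sweeps (levelTop m) (levelBottom m) (sym (piecewise-> m<n)) (levelTop-sweeps m m<n) junction (levelBottom-sweeps m m<n) refl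
  where
  top-end : ∀ m → levelTop {n} m 0 ≡ rows [ m , suc m ⟩ [ m , suc m ⟩
  top-end zero    = refl
  top-end (suc m) = refl
  junction : levelBottom m n ≡ levelTop m 0
  junction with m≤n⇒m<n∨m≡n m<n
  ... | inj₁ 1+m<n = trans (piecewise-> 1+m<n) (sym (top-end m))
  ... | inj₂ refl  = trans (piecewise-≡ (suc m)) (trans (rows-cong clipped λ _ → ⇔-id _) (sym (top-end m)))
    where
    clipped : ∀ {k} → k < suc m → k ∈ᵢ [ m , suc (suc m) ⟩ ⇔ k ∈ᵢ [ m , suc m ⟩
    clipped k<1+m = mk⇔ (λ (m≤k , _) → m≤k , k<1+m) (λ (m≤k , k<1+m) → m≤k , m<n⇒m<1+n k<1+m)

empty : ∀ {n} → SubsetP n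
empty = rows [ 0 , 0 ⟩ [ 0 , 0 ⟩

full : ∀ {n} → SubsetP n
full {n} = rows [ 0 , n ⟩ [ 0 , n ⟩

Row-empty : ∀ {n} → Row (empty {n}) ≡ full
Row-empty {n} = Row-sweeps top bottom start top-steps junction bottom-steps refl
  where
  top bottom : ℕ → SubsetP n
  top k    = rows [ 0 , 0 ⟩ [ k , n ⟩
  bottom k = rows [ k , n ⟩ [ 0 , n ⟩
  top-steps : Sweeps (suc zero) top
  top-steps k k<n = toggle-top k<n (flip-extendˡ k<n) (empty-bottom ≤-refl)
  bottom-steps : Sweeps zero bottom
  bottom-steps k k<n = toggle-bottom k<n (flip-extendˡ k<n) (top-≤-bottom ≤-refl z≤n)
  start : empty ≡ top n
  start = rows-cong (λ _ → ⇔-id _) λ _ → both-absent (∉-empty ≤-refl) (∉-empty ≤-refl)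
  junction : bottom n ≡ top 0
  junction = rows-cong (λ _ → both-absent (∉-empty ≤-refl) (∉-empty ≤-refl)) λ _ → ⇔-id _

Row-full : ∀ {n} → Row (full {n}) ≡ empty
Row-full {n} = Row-sweeps top bottom refl top-steps refl bottom-steps refl
  where
  top bottom : ℕ → SubsetP n
  top k    = rows [ 0 , n ⟩ [ 0 , k ⟩
  bottom k = rows [ 0 , k ⟩ [ 0 , 0 ⟩
  top-steps : Sweeps (suc zero) top
  top-steps k k<n = toggle-top k<n (flip-shrinkʳ z≤n) (top-≤-bottom (<⇒≤ k<n) ≤-refl)
  bottom-steps : Sweeps zero bottom
  bottom-steps k k<n = toggle-bottom k<n (flip-shrinkʳ z≤n) (top-≤-bottom z≤n z≤n)

allButMax : ∀ {n} → SubsetP n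
allButMax {n} = rows [ 0 , n ⟩ [ 0 , n ∸ 1 ⟩

allButMin : ∀ {n} → SubsetP n
allButMin {n} = rows [ 1 , n ⟩ [ 0 , n ⟩

level-last : ∀ {p} → level {suc p} (suc p) ≡ rows [ suc p , suc p ⟩ [ p , suc p ⟩
level-last = rows-cong (λ k<n → both-absent (∉-below k<n) (∉-below k<n)) λ _ → ⇔-id _

Row-level-last : ∀ {p} → Row (level {suc p} (suc p)) ≡ allButMax
Row-level-last {p} = Row-sweeps top bottom start top-steps refl bottom-steps refl
  where
  top bottom : ℕ → SubsetP (suc p)
  top k    = piecewise k (suc p) (rows [ suc p , suc p ⟩ [ k , p ⟩) last last
    where
    last : SubsetP (suc p)
    last = rows [ suc p , suc p ⟩ [ p , suc p ⟩
  bottom k = rows [ k , suc p ⟩ [ 0 , p ⟩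
  top-steps : Sweeps (suc zero) top
  top-steps k k<n with m≤n⇒m<n∨m≡n (≤-pred k<n)
  ... | inj₁ k<p = toggles-resp-≡ (piecewise-< (s≤s k<p))
      (toggle-top k<n (flip-extendˡ k<p) (empty-bottom ≤-refl)) (piecewise-< (m<n⇒m<1+n k<p))
  ... | inj₂ refl = toggles-resp-≡ (piecewise-≡ (suc k))
      (toggle-top k<n (flip-shrinkʳ ≤-refl) (empty-bottom ≤-refl)) (piecewise-< (n<1+n k))
  bottom-steps : Sweeps zero bottom
  bottom-steps k k<n = toggle-bottom k<n (flip-extendˡ k<n) (top-≤-bottom (n≤1+n p) z≤n)
  start : level (suc p) ≡ top (suc p)
  start = trans level-last (sym (piecewise-≡ (suc p)))

Row-allButMax : ∀ {p} → Row (allButMax {suc p}) ≡ allButMin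
Row-allButMax {p} = Row-sweeps top bottom start top-steps refl bottom-steps refl
  where
  0<n : 0 < suc p
  0<n = s≤s z≤n
  p<n : p < suc p
  p<n = n<1+n p
  top : ℕ → SubsetP (suc p)
  top k = piecewise k (suc p) full allButMax allButMax
  start : allButMax ≡ top (suc p)
  start = sym (piecewise-≡ (suc p))
  bottom : ℕ → SubsetP (suc p)
  bottom zero    = allButMin
  bottom (suc _) = full
  top-steps : Sweeps (suc zero) top
  top-steps k k<n with m≤n⇒m<n∨m≡n (≤-pred k<n)
  ... | inj₁ k<p = toggles-resp-≡ (piecewise-< (s≤s k<p)) blocked (piecewise-< (m<n⇒m<1+n k<p))
    where
    blocked : full ─⟨ suc zero , fromℕ< k<n ⟩→ full
    blocked = toggle-blocked (zero , fromℕ< 0<n) (suc zero , fromℕ< k<n) (suc zero , fromℕ< p<n)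
      (indicator-∈ [ 0 , suc p ⟩ (toℕ-fromℕ< 0<n) (z≤n , 0<n))
      (trans (flipped-other [ 0 , suc p ⟩ (fromℕ<-≢ p<n k<n (<⇒≢ k<p ∘ sym)))
             (indicator-∈ [ 0 , suc p ⟩ (toℕ-fromℕ< p<n) (z≤n , p<n)))
      (fromℕ<-≤P 0<n k<n z≤n z≤n) (fromℕ<-≤P k<n p<n ≤-refl (<⇒≤ k<p))
      (flipped-∉ [ 0 , suc p ⟩ (toℕ-fromℕ< k<n) (z≤n , k<n))
  ... | inj₂ refl = toggles-resp-≡ (piecewise-≡ (suc k))
      (toggle-top k<n (flip-extendʳ z≤n) (top-≤-bottom ≤-refl ≤-refl)) (piecewise-< (n<1+n k))
  bottom-steps : Sweeps zero bottom
  bottom-steps zero    k<n = toggle-bottom k<n (flip-shrinkˡ k<n) (top-≤-bottom ≤-refl z≤n)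
  bottom-steps (suc k) k<n = toggle-blocked (zero , fromℕ< 0<n) (zero , fromℕ< k<n) (suc zero , fromℕ< p<n)
      (trans (flipped-other [ 0 , suc p ⟩ (fromℕ<-≢ 0<n k<n λ ()))
             (indicator-∈ [ 0 , suc p ⟩ (toℕ-fromℕ< 0<n) (z≤n , 0<n)))
      (indicator-∈ [ 0 , suc p ⟩ (toℕ-fromℕ< p<n) (z≤n , p<n))
      (fromℕ<-≤P 0<n k<n z≤n z≤n) (fromℕ<-≤P k<n p<n z≤n (≤-pred k<n))
      (flipped-∉ [ 0 , suc p ⟩ (toℕ-fromℕ< k<n) (z≤n , k<n))

Row-allButMin : ∀ {p} → Row (allButMin {suc p}) ≡ level 0
Row-allButMin {p} = Row-sweeps top bottom refl top-steps refl bottom-steps refl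
  where
  top : ℕ → SubsetP (suc p)
  top k = rows [ 1 , suc p ⟩ [ 0 , k ⟩
  bottom : ℕ → SubsetP (suc p)
  bottom zero    = level 0
  bottom (suc k) = rows [ 1 , suc k ⟩ [ 0 , 0 ⟩
  top-steps : Sweeps (suc zero) top
  top-steps k k<n = toggle-top k<n (flip-shrinkʳ z≤n) (top-≤-bottom (<⇒≤ k<n) z≤n)
  bottom-steps : Sweeps zero bottom
  bottom-steps zero    k<n = toggle-bottom k<n (flip-fill ≤-refl) (top-≤-bottom z≤n z≤n)
  bottom-steps (suc k) k<n = toggle-bottom k<n (flip-shrinkʳ (s≤s z≤n)) (top-≤-bottom z≤n z≤n)

iterate-level : ∀ {n m} → m ≤ n → iterate Row m (level {n} 0) ≡ level m
iterate-level {m = zero}  _   = refl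
iterate-level {m = suc m} m<n = trans (cong Row (iterate-level (<⇒≤ m<n))) (Row-level m<n)

iterate-allButMax : ∀ {p} → iterate Row (suc (suc p)) (level {suc p} 0) ≡ allButMax
iterate-allButMax {p} = trans (cong Row (iterate-level {suc p} {suc p} ≤-refl)) (Row-level-last {p})

iterate-allButMin : ∀ {p} → iterate Row (suc (suc (suc p))) (level {suc p} 0) ≡ allButMin
iterate-allButMin {p} = trans (cong Row (iterate-allButMax {p})) (Row-allButMax {p})

cell-mismatch : ∀ {n} {S T : SubsetP n} → S ≡ T → ∀ i j → lookup (lookup S i) j ≡ true → lookup (lookup T i) j ≢ false
cell-mismatch refl i j S∋ T∌ with () ← trans (sym S∋) T∌

level-orbit : ∀ {p} → 0 < p → IsOrbitSize (level {suc p} 0) (suc (suc (suc (suc p))))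
level-orbit {p} 0<p = s≤s z≤n , trans (cong Row (iterate-allButMin {p})) (Row-allButMin {p}) , returns-late
  where
  0∈level0 : lookup (indicator {suc p} [ 0 , 1 ⟩) zero ≡ true
  0∈level0 = indicator-∈ [ 0 , 1 ⟩ refl (z≤n , s≤s z≤n)
  NotBack : ℕ → Set
  NotBack j = iterate Row j (level {suc p} 0) ≢ level 0
  not-back-early : ∀ {j} → 0 < j → j ≤ suc p → NotBack j
  not-back-early {j} 0<j j≤n back = cell-mismatch (trans (sym back) (iterate-level j≤n)) zero zero
                                      0∈level0 (indicator-∉ [ j , suc j ⟩ refl (∉-below 0<j))
  not-back-at-max : NotBack (suc (suc p))
  not-back-at-max back = cell-mismatch (trans (sym (iterate-allButMax {p})) back) (suc zero) zero
                           (indicator-∈ [ 0 , p ⟩ refl (z≤n , 0<p)) (indicator-∉ [ 0 , 0 ⟩ refl (∉-empty z≤n))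
  not-back-at-min : NotBack (suc (suc (suc p)))
  not-back-at-min back = cell-mismatch (trans (sym back) (iterate-allButMin {p})) zero zero
                           0∈level0 (indicator-∉ [ 1 , suc p ⟩ refl (∉-below (s≤s z≤n)))
  -- A case split by with would normalise the goal, and with it Row.
  returns-late : ∀ j → 0 < j → j < suc (suc (suc (suc p))) → NotBack j
  returns-late j 0<j j<4+p = before-min (m≤n⇒m<n∨m≡n (≤-pred j<4+p))
    where
    before-max : j < suc (suc p) ⊎ j ≡ suc (suc p) → NotBack j
    before-max (inj₁ j<2+p) = not-back-early 0<j (≤-pred j<2+p)
    before-max (inj₂ j≡2+p) = subst NotBack (sym j≡2+p) not-back-at-max
    before-min : j < suc (suc (suc p)) ⊎ j ≡ suc (suc (suc p)) → NotBack j
    before-min (inj₁ j<3+p) = before-max (m≤n⇒m<n∨m≡n (≤-pred j<3+p))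
    before-min (inj₂ j≡3+p) = subst NotBack (sym j≡3+p) not-back-at-min

iterate-empty : ∀ {n} → iterate Row (suc zero) (empty {n}) ≡ full
iterate-empty {n} = trans (cong Row no-steps) (Row-empty {n})
  where
  -- Stated separately so that iterate Row 1 empty is never converted to Row empty by unfolding Row.
  no-steps : iterate Row zero (empty {n}) ≡ empty
  no-steps = refl

empty-orbit : ∀ {n} → IsOrbitSize (empty {suc n}) (suc (suc zero))
empty-orbit {n} = s≤s z≤n , trans (cong Row (iterate-empty {suc n})) (Row-full {suc n}) , returns-late
  where
  returns-late : ∀ j → 0 < j → j < suc (suc zero) → iterate Row j (empty {suc n}) ≢ empty
  returns-late (suc zero) _ _ back = cell-mismatch (trans (sym (iterate-empty {suc n})) back) zero zero
                                       (indicator-∈ [ 0 , suc n ⟩ refl (z≤n , s≤s z≤n))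
                                       (indicator-∉ [ 0 , 0 ⟩ refl (∉-empty z≤n))
  returns-late (suc (suc _)) _ (s≤s (s≤s ()))

-- Signed cardinality along the orbits

sumℤ : List ℤ → ℤ
sumℤ = foldr _+_ (+ 0)

sumℤ-++ : ∀ xs ys → sumℤ (xs ++ ys) ≡ sumℤ xs + sumℤ ys
sumℤ-++ []       ys = sym (ℤ.+-identityˡ (sumℤ ys))
sumℤ-++ (x ∷ xs) ys = trans (cong (_+_ x) (sumℤ-++ xs ys)) (sym (ℤ.+-assoc x (sumℤ xs) (sumℤ ys)))

Σ< : ℕ → (ℕ → ℤ) → ℤ
Σ< zero    f = + 0
Σ< (suc m) f = Σ< m f + f m

Σ<-unshift : ∀ m f → f 0 + Σ< m (f ∘ suc) ≡ Σ< (suc m) f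
Σ<-unshift zero    f = trans (ℤ.+-identityʳ (f 0)) (sym (ℤ.+-identityˡ (f 0)))
Σ<-unshift (suc m) f = trans (sym (ℤ.+-assoc (f 0) _ _)) (cong (_+ f (suc m)) (Σ<-unshift m f))

sumℤ-tabulate : ∀ m (f : ℕ → ℤ) → sumℤ (List.tabulate {n = m} (f ∘ toℕ)) ≡ Σ< m f
sumℤ-tabulate zero    f = refl
sumℤ-tabulate (suc m) f = trans (cong (_+_ (f 0)) (sumℤ-tabulate m (f ∘ suc))) (Σ<-unshift m f)

restrict : Interval → (ℕ → ℤ) → ℕ → ℤ
restrict I f k = if does (k ∈ᵢ? I) then f k else + 0

intervalSum : (ℕ → ℤ) → Interval → ℤ
intervalSum f [ a , b ⟩ = Σ< b f - Σ< a f

restrict-∈ : ∀ {I k} f → k ∈ᵢ I → restrict I f k ≡ f k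
restrict-∈ {I} {k} f k∈I = cong (λ b → if b then f k else + 0) (dec-true (k ∈ᵢ? I) k∈I)

restrict-∉ : ∀ {I k} f → ¬ k ∈ᵢ I → restrict I f k ≡ + 0
restrict-∉ {I} {k} f k∉I = cong (λ b → if b then f k else + 0) (dec-false (k ∈ᵢ? I) k∉I)

Σ<-restrict : ∀ {a b} f → a ≤ b → ∀ m → Σ< m (restrict [ a , b ⟩ f) ≡ Σ< (m ⊓ b) f - Σ< (m ⊓ a) f
Σ<-restrict f a≤b zero = refl
Σ<-restrict {a} {b} f a≤b (suc m) with m <? a | m <? b
... | yes m<a | _
  rewrite Σ<-restrict f a≤b m | restrict-∉ {[ a , b ⟩} f (∉-below m<a)
        | m≤n⇒m⊓n≡m (<⇒≤ (<-≤-trans m<a a≤b)) | m≤n⇒m⊓n≡m (<-≤-trans m<a a≤b)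
        | m≤n⇒m⊓n≡m (<⇒≤ m<a) | m≤n⇒m⊓n≡m m<a
  = trans (ℤ.+-identityʳ _) (trans (ℤ.+-inverseʳ (Σ< m f)) (sym (ℤ.+-inverseʳ (Σ< (suc m) f))))
... | no m≮a | yes m<b
  rewrite Σ<-restrict f a≤b m | restrict-∈ {[ a , b ⟩} f (≮⇒≥ m≮a , m<b)
        | m≤n⇒m⊓n≡m (<⇒≤ m<b) | m≤n⇒m⊓n≡m m<b
        | m≥n⇒m⊓n≡n (≮⇒≥ m≮a) | m≥n⇒m⊓n≡n (m≤n⇒m≤1+n (≮⇒≥ m≮a))
  = slide (Σ< m f) (Σ< a f) (f m)
  where
  slide : ∀ x y z → (x - y) + z ≡ (x + z) - y
  slide = solve-∀
... | no m≮a | no m≮b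
  rewrite Σ<-restrict f a≤b m | restrict-∉ {[ a , b ⟩} f (∉-above (≮⇒≥ m≮b))
        | m≥n⇒m⊓n≡n (≮⇒≥ m≮b) | m≥n⇒m⊓n≡n (m≤n⇒m≤1+n (≮⇒≥ m≮b))
        | m≥n⇒m⊓n≡n (≮⇒≥ m≮a) | m≥n⇒m⊓n≡n (m≤n⇒m≤1+n (≮⇒≥ m≮a))
  = ℤ.+-identityʳ _

Σ<-interval : ∀ {n a b} f → a ≤ b → b ≤ n → Σ< n (restrict [ a , b ⟩ f) ≡ intervalSum f [ a , b ⟩
Σ<-interval {n} {a} {b} f a≤b b≤n =
  trans (Σ<-restrict f a≤b n)
        (cong₂ (λ x y → Σ< x f - Σ< y f) (m≥n⇒m⊓n≡n b≤n) (m≥n⇒m⊓n≡n (≤-trans a≤b b≤n)))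

contribution : ∀ {n} → SubsetP n → Pt n → ℤ
contribution S (i , j) = if lookup (lookup S i) j then scPt (i , j) else + 0

-- The summand of sc is local to sc, so the left side of sc-summand is inferred from its use in sc-as-sum.
mutual
  sc-as-sum : ∀ {n} (S : SubsetP n) → sc S ≡ sumℤ (map (contribution S) (linExt n))
  sc-as-sum {n} S = cong sumℤ (map-cong (sc-summand S) (linExt n))

  sc-summand : ∀ {n} (S : SubsetP n) (x : Pt n) → _ ≡ contribution S x
  sc-summand S x with x ∈P? S
  ... | yes x∈S = cong (λ b → if b then scPt x else + 0) (sym x∈S)
  ... | no x∉S  = cong (λ b → if b then scPt x else + 0) (sym (¬-not x∉S))

sign : ℕ → ℤ
sign k = -1ℤ ^ k

sc-by-rows : ∀ {n} (S : SubsetP n) →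
             sc S ≡ sumℤ (map (contribution S) (rowPoints zero)) + sumℤ (map (contribution S) (rowPoints (suc zero)))
sc-by-rows {n} S = begin
  sc S                                                                       ≡⟨ sc-as-sum S ⟩
  sumℤ (map c (rowPoints zero ++ rowPoints (suc zero) ++ []))                ≡⟨ cong sumℤ (map-++ c (rowPoints zero) _) ⟩
  sumℤ (map c (rowPoints zero) ++ map c (rowPoints (suc zero) ++ []))        ≡⟨ sumℤ-++ (map c (rowPoints zero)) _ ⟩
  sumℤ (map c (rowPoints zero)) + sumℤ (map c (rowPoints (suc zero) ++ []))  ≡⟨ cong (λ xs → row₀ + sumℤ (map c xs)) ++-[] ⟩
  sumℤ (map c (rowPoints zero)) + sumℤ (map c (rowPoints (suc zero)))        ∎
  where
  open ≡-Reasoning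
  c : Pt n → ℤ
  c = contribution S
  row₀ : ℤ
  row₀ = sumℤ (map c (rowPoints zero))
  ++-[] : rowPoints (suc zero) ++ [] ≡ rowPoints (suc zero)
  ++-[] = ++-identityʳ (rowPoints {n} (suc zero))

row-contribution : ∀ {n} (S : SubsetP n) i {a b} f → a ≤ b → b ≤ n → lookup S i ≡ indicator [ a , b ⟩ →
                   (∀ j → scPt (i , j) ≡ f (toℕ j)) → sumℤ (map (contribution S) (rowPoints i)) ≡ intervalSum f [ a , b ⟩
row-contribution {n} S i {a} {b} f a≤b b≤n row-i scPt-i = begin
  sumℤ (map (contribution S) (rowPoints i))                  ≡⟨ cong sumℤ (trans (cong (map _) (map-tabulate id (i ,_)))
                                                                                 (map-tabulate (i ,_) (contribution S))) ⟩
  sumℤ (List.tabulate {n = n} (contribution S ∘ (i ,_)))     ≡⟨ cong sumℤ (Listₚ.tabulate-cong pointwise) ⟩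
  sumℤ (List.tabulate {n = n} (restrict [ a , b ⟩ f ∘ toℕ))  ≡⟨ sumℤ-tabulate n (restrict [ a , b ⟩ f) ⟩
  Σ< n (restrict [ a , b ⟩ f)                                ≡⟨ Σ<-interval f a≤b b≤n ⟩
  intervalSum f [ a , b ⟩                                    ∎
  where
  open ≡-Reasoning
  pointwise : ∀ j → contribution S (i , j) ≡ restrict [ a , b ⟩ f (toℕ j)
  pointwise j = cong₂ (λ c x → if c then x else + 0)
    (trans (cong (λ r → lookup r j) row-i) (lookup-indicator [ a , b ⟩ j)) (scPt-i j)

sc-rows : ∀ {n} a₀ b₀ a₁ b₁ → a₀ ≤ b₀ → b₀ ≤ n → a₁ ≤ b₁ → b₁ ≤ n →
          sc (rows {n} [ a₀ , b₀ ⟩ [ a₁ , b₁ ⟩)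
            ≡ intervalSum sign [ a₀ , b₀ ⟩ + intervalSum (sign ∘ suc) [ a₁ , b₁ ⟩
sc-rows {n} a₀ b₀ a₁ b₁ a₀≤b₀ b₀≤n a₁≤b₁ b₁≤n =
  trans (sc-by-rows S) (cong₂ _+_ (row-contribution S zero sign a₀≤b₀ b₀≤n refl λ _ → refl)
                                  (row-contribution S (suc zero) (sign ∘ suc) a₁≤b₁ b₁≤n refl λ _ → refl))
  where
  S : SubsetP n
  S = rows [ a₀ , b₀ ⟩ [ a₁ , b₁ ⟩

sign-suc : ∀ k → sign (suc k) ≡ - sign k
sign-suc k = ℤ.-1*i≡-i (sign k)

Σ<-alternating : ∀ {f} → (∀ k → f (suc k) ≡ - f k) → ∀ t → Σ< (t * 2) f ≡ + 0
Σ<-alternating alt zero = refl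
Σ<-alternating {f} alt (suc t) =
  trans (cong₂ (λ s y → (s + f (t * 2)) + y) (Σ<-alternating alt t) (alt (t * 2))) (cancel (f (t * 2)))
  where
  cancel : ∀ x → (+ 0 + x) + - x ≡ + 0
  cancel = solve-∀

alternating-even : ∀ {f : ℕ → ℤ} → (∀ k → f (suc k) ≡ - f k) → ∀ t → f (t * 2) ≡ f 0
alternating-even alt zero = refl
alternating-even {f} alt (suc t) =
  trans (alt (suc (t * 2))) (trans (cong -_ (alt (t * 2))) (trans (ℤ.neg-involutive _) (alternating-even alt t)))

orbitSum-step : ∀ {n a b} (I : SubsetP n) k → orbitSum I k ≡ a → sc (iterate Row k I) ≡ b → orbitSum I (suc k) ≡ a + b
orbitSum-step I k = cong₂ _+_

orbitSum-level : ∀ {n m} → m < n → orbitSum (level {n} 0) (suc m) ≡ Σ< (suc m) sign + Σ< m (sign ∘ suc)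
orbitSum-level {n} {zero} 0<n = orbitSum-step (level {n} 0) zero refl (sc-rows 0 1 0 0 z≤n 0<n z≤n z≤n)
orbitSum-level {n} {suc m} 1+m<n =
  trans (orbitSum-step (level {n} 0) (suc m) (orbitSum-level (<-trans (n<1+n m) 1+m<n)) sc-level)
        (telescope (Σ< (suc m) sign) (Σ< m (sign ∘ suc)) (Σ< (suc (suc m)) sign) (Σ< (suc m) (sign ∘ suc)))
  where
  sc-level : sc (iterate Row (suc m) (level {n} 0))
               ≡ intervalSum sign [ suc m , suc (suc m) ⟩ + intervalSum (sign ∘ suc) [ m , suc m ⟩
  sc-level = trans (cong sc (iterate-level (<⇒≤ 1+m<n)))
                   (sc-rows (suc m) (suc (suc m)) m (suc m) (n≤1+n (suc m)) 1+m<n (n≤1+n m) (<⇒≤ 1+m<n))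
  telescope : ∀ a a′ b b′ → (a + a′) + ((b - a) + (b′ - a′)) ≡ b + b′
  telescope = solve-∀

distinct-averages⇒¬ScHomomesic : ∀ {n} (I J : SubsetP n) k l → IsICS I → IsICS J → IsOrbitSize I k → IsOrbitSize J l →
                                 orbitAvg I k ≢ orbitAvg J l → ¬ ScHomomesic n
distinct-averages⇒¬ScHomomesic I J k l icsI icsJ orbitI orbitJ averages≢ (_ , homomesic) =
  averages≢ (trans (homomesic I icsI k orbitI) (sym (homomesic J icsJ l orbitJ)))

orbitAvg-by-sum : ∀ {n v} (I : SubsetP n) k → orbitSum I (suc k) ≡ v → orbitAvg I (suc k) ≡ v / suc k
orbitAvg-by-sum I k sum≡v = cong (_/ suc k) sum≡v

-2/[1+k]≢0/2 : ∀ k → -[1+ 1 ] / suc k ≢ + 0 / 2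
-2/[1+k]≢0/2 k eq with /-injective-≃ (mkℚᵘ -[1+ 1 ] k) (mkℚᵘ (+ 0) 1) eq
... | *≡* ()

module _ {p : ℕ} (Σsign≡0 : Σ< (suc p) sign ≡ + 0) (Σsign′≡0 : Σ< (suc p) (sign ∘ suc) ≡ + 0)
         (Σsign′≡-1 : Σ< p (sign ∘ suc) ≡ -[1+ 0 ]) where

  level-orbitSum : orbitSum (level {suc p} 0) (suc (suc (suc (suc p)))) ≡ -[1+ 1 ]
  level-orbitSum =
    trans (orbitSum-step (level {suc p} 0) (suc (suc (suc p)))
            (orbitSum-step (level {suc p} 0) (suc (suc p))
              (orbitSum-step (level {suc p} 0) (suc p) (orbitSum-level {suc p} {p} ≤-refl) sc-last) sc-max) sc-min)
          (evaluate Σsign≡0 Σsign′≡0 Σsign′≡-1)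
    where
    sign′ : ℕ → ℤ
    sign′ = sign ∘ suc
    sc-last : sc (iterate Row (suc p) (level {suc p} 0)) ≡ intervalSum sign [ suc p , suc p ⟩ + intervalSum sign′ [ p , suc p ⟩
    sc-last = trans (cong sc (trans (iterate-level {suc p} {suc p} ≤-refl) level-last))
                    (sc-rows (suc p) (suc p) p (suc p) ≤-refl ≤-refl (n≤1+n p) ≤-refl)
    sc-max : sc (iterate Row (suc (suc p)) (level {suc p} 0)) ≡ intervalSum sign [ 0 , suc p ⟩ + intervalSum sign′ [ 0 , p ⟩
    sc-max = trans (cong sc (iterate-allButMax {p})) (sc-rows 0 (suc p) 0 p z≤n ≤-refl z≤n (n≤1+n p))
    sc-min : sc (iterate Row (suc (suc (suc p))) (level {suc p} 0))
               ≡ intervalSum sign [ 1 , suc p ⟩ + intervalSum sign′ [ 0 , suc p ⟩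
    sc-min = trans (cong sc (iterate-allButMin {p})) (sc-rows 1 (suc p) 0 (suc p) (s≤s z≤n) ≤-refl z≤n ≤-refl)
    evaluate : ∀ {x y z} → x ≡ + 0 → y ≡ + 0 → z ≡ -[1+ 0 ] →
               ((x + z) + ((x - x) + (y - z))) + ((x - + 0) + (z - + 0)) + ((x - + 1) + (y - + 0)) ≡ -[1+ 1 ]
    evaluate refl refl refl = refl

  empty-orbitSum : orbitSum (empty {suc p}) (suc (suc zero)) ≡ + 0
  empty-orbitSum =
    trans (orbitSum-step (empty {suc p}) (suc zero) (orbitSum-step (empty {suc p}) zero refl sc-empty) sc-full)
          (cong₂ (λ x y → (+ 0 + (+ 0 + + 0)) + ((x - + 0) + (y - + 0))) Σsign≡0 Σsign′≡0)
    where
    sc-empty : sc (iterate Row zero (empty {suc p})) ≡ intervalSum sign [ 0 , 0 ⟩ + intervalSum (sign ∘ suc) [ 0 , 0 ⟩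
    sc-empty = sc-rows {suc p} 0 0 0 0 z≤n z≤n z≤n z≤n
    sc-full : sc (iterate Row (suc zero) (empty {suc p}))
                ≡ intervalSum sign [ 0 , suc p ⟩ + intervalSum (sign ∘ suc) [ 0 , suc p ⟩
    sc-full = trans (cong sc (iterate-empty {suc p})) (sc-rows 0 (suc p) 0 (suc p) z≤n ≤-refl z≤n ≤-refl)

  averages≢ : orbitAvg (level {suc p} 0) (suc (suc (suc (suc p)))) ≢ orbitAvg (empty {suc p}) (suc (suc zero))
  averages≢ = subst₂ _≢_ (sym (orbitAvg-by-sum (level {suc p} 0) (suc (suc (suc p))) level-orbitSum))
                         (sym (orbitAvg-by-sum (empty {suc p}) (suc zero) empty-orbitSum))
                         (-2/[1+k]≢0/2 (suc (suc (suc p))))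

  ¬ScHomomesic-balanced : 0 < p → ¬ ScHomomesic (suc p)
  ¬ScHomomesic-balanced 0<p =
    distinct-averages⇒¬ScHomomesic (level {suc p} 0) (empty {suc p}) (suc (suc (suc (suc p)))) (suc (suc zero))
      (rows-isICS (top-≤-bottom z≤n z≤n)) (rows-isICS (empty-bottom ≤-refl))
      (level-orbit {p} 0<p) (empty-orbit {p}) averages≢

¬ScHomomesic-even : ∀ t → ¬ ScHomomesic (suc t * 2)
¬ScHomomesic-even t = subst (λ n → ¬ ScHomomesic n) 2+2t≡2[1+t]
  (¬ScHomomesic-balanced {suc (t * 2)} (Σ<-alternating sign-suc (suc t)) (Σ<-alternating (sign-suc ∘ suc) (suc t))
    (cong₂ _+_ (Σ<-alternating (sign-suc ∘ suc) t) (trans (sign-suc (t * 2)) (cong -_ (alternating-even sign-suc t))))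
    (s≤s z≤n))
  where
  -- Transporting along this definitional equation, rather than letting Agda convert the two forms of n,
  -- keeps it from unfolding Row inside ScHomomesic.
  2+2t≡2[1+t] : suc (suc (t * 2)) ≡ suc t * 2
  2+2t≡2[1+t] = refl

proposition3p29 : (n : ℕ) → 0 < n → 2 ∣ n → ¬ ScHomomesic n
proposition3p29 .0 () (divides zero refl)
proposition3p29 _ _ (divides (suc t) refl) = ¬ScHomomesic-even t
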